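{- Let $\mathsf{CS}$ be a constant specification for $\mathsf{LPC}^+$ and let $\mathcal M=(W,W_N,R_{Fm},R_{Tm},V)$ be the canonical relational model for $\mathsf{LPC}^+_{\mathsf{CS}}$. Then for every formula $\phi$ and every $\Gamma\in W$: $(\mathcal M,\Gamma)\vDash\phi$ iff $\phi\in\Gamma$.
   Context: Language: countable sets $\mathsf{Const}$, $\mathsf{Var}$, $\mathsf{Prop}$; terms $t ::= c \mid x \mid t\cdot t \mid t+t \mid\ !t$; formulas $\phi ::= p \mid \neg\phi \mid \phi\wedge\phi \mid \phi\supset\phi \mid \phi>\phi \mid t{:}\phi$; $\mathsf{Fm}$ is the set of formulas. Axiom schemes of $\mathsf{LPC}^+$: (A1) classical tautologies; (A2) $(\phi>(\psi\supset\chi))\supset((\phi>\psi)\supset(\phi>\chi))$; (A3) $\phi>\phi$; (A4) $(\phi>\psi)\supset(\phi\supset\psi)$; (A5) $(s{:}(\phi>\psi)\wedge t{:}\phi)>(s\cdot t){:}\psi$; (A6) $s{:}\phi>(s+t){:}\phi$; (A7) $t{:}\phi>(s+t){:}\phi$; (A8) $t{:}\phi>\phi$; (A9) $t{:}\phi>{!t}{:}t{:}\phi$. A constant specification $\mathsf{CS}$ is a set of formulas $c{:}\phi$, $c\in\mathsf{Const}$, $\phi$ an instance of (A1)–(A9). $\vdash_{\mathsf{LPC}^+_{\mathsf{CS}}}\phi$: derivable from instances of (A1)–(A9) and $\mathsf{CS}$ by Modus Ponens and (RCN) (from $\psi$ infer $\phi>\psi$). For a set $T$, $T\vdash\phi$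 iff $\vdash(\psi_1\wedge\cdots\wedge\psi_n)\supset\phi$ for some $\psi_1,\dots,\psi_n\in T$. $T$ is consistent if $T\nvdash\bot$ (with $\bot$ a formula $\chi\wedge\neg\chi$), maximal consistent if consistent with no proper consistent extension; $\mathsf{MCS}$ is the set of maximal consistent sets. Truth in a relational model $(W,W_N,R_{Fm},R_{Tm},V)$ (with $W_N\subseteq W$, $R_\phi\subseteq W_N\times W_N$, $R_t\subseteq W\times W$, $V$ mapping normal states to subsets of $\mathsf{Prop}$ and non-normal states to sets of formulas): at $w\in W\setminus W_N$, $w\vDash\phi$ iff $\phi\in V(w)$; at $w\in W_N$: $p$ iff $p\in V(w)$; $\neg,\wedge,\supset$ classically; $\phi>\psi$ iff every $v$ with $wR_\phi v$ satisfies $\psi$; $t{:}\phi$ iff every $v\in W$ with $wR_tv$ satisfies $\phi$. The canonical model: $W=$ the power set of $\mathsf{Fm}$; $W_N=\mathsf{MCS}$; for $\Gamma,\Delta\in W_N$, $\Gamma R_\phi\Delta$ iff $\Gamma/\phi\subseteq\Delta$ where $\Gamma/\phi=\{\psi: \phi>\psi\in\Gamma\}$; for $\Gamma,\Delta\in W$, $\Gamma R_t\Delta$ iff $\Gamma/t\subseteq\Delta$ where $\Gamma/t=\{\psi: t{:}\psi\in\Gamma\}$; $V(\Gamma)=\Gamma$ for $\Gamma\in W\setminus W_N$ and $V(\Gamma)=\mathsf{Prop}\cap\Gamma$ for $\Gamma\in W_N$. -}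

module Defs where

open import Level using (Level; 0ℓ) renaming (suc to lsuc)
open import Data.Nat using (ℕ)
open import Data.Bool using (Bool; true; false; not; _∧_; _∨_)
open import Data.List using (List; []; _∷_)
open import Data.List.Relation.Unary.All using (All)
open import Data.Product using (Σ; _×_; _,_; ∃)
open import Relation.Binary.PropositionalEquality using (_≡_)
open import Relation.Nullary using (¬_)

Const Var Prop : Set
Const = ℕ
Var   = ℕ
Prop  = ℕ

infixl 7 _·_
infixl 6 _⊕_
data Tm : Set where
  con  : Const → Tm
  var  : Var → Tm
  _·_  : Tm → Tm → Tm
  _⊕_  : Tm → Tm → Tm
  !_   : Tm → Tm

infixr 4 _⊃_
infixr 4 _▷_
infixr 5 _∧'_
infix  6 _∶_
data Fm : Set where
  atom : Prop → Fm
  ¬'_  : Fm → Fm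
  _∧'_ : Fm → Fm → Fm
  _⊃_  : Fm → Fm → Fm
  _▷_  : Fm → Fm → Fm
  _∶_  : Tm → Fm → Fm

-- (A1): classical tautologies.  A formula is a tautology iff it is true
-- under every Boolean valuation that treats the non-Boolean formulas
-- (atoms, φ > ψ, t : φ) as propositional atoms.

evalB : (Fm → Bool) → Fm → Bool
evalB v (atom p) = v (atom p)
evalB v (¬' φ)   = not (evalB v φ)
evalB v (φ ∧' ψ) = evalB v φ ∧ evalB v ψ
evalB v (φ ⊃ ψ)  = not (evalB v φ) ∨ evalB v ψ
evalB v (φ ▷ ψ)  = v (φ ▷ ψ)
evalB v (t ∶ φ)  = v (t ∶ φ)

Tautology : Fm → Set
Tautology φ = (v : Fm → Bool) → evalB v φ ≡ true

data Axiom : Fm → Set where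
  A1 : ∀ {φ} → Tautology φ → Axiom φ
  A2 : ∀ φ ψ χ → Axiom ((φ ▷ (ψ ⊃ χ)) ⊃ ((φ ▷ ψ) ⊃ (φ ▷ χ)))
  A3 : ∀ φ → Axiom (φ ▷ φ)
  A4 : ∀ φ ψ → Axiom ((φ ▷ ψ) ⊃ (φ ⊃ ψ))
  A5 : ∀ s t φ ψ → Axiom (((s ∶ (φ ▷ ψ)) ∧' (t ∶ φ)) ▷ ((s · t) ∶ ψ))
  A6 : ∀ s t φ → Axiom ((s ∶ φ) ▷ ((s ⊕ t) ∶ φ))
  A7 : ∀ s t φ → Axiom ((t ∶ φ) ▷ ((s ⊕ t) ∶ φ))
  A8 : ∀ t φ → Axiom ((t ∶ φ) ▷ φ)
  A9 : ∀ t φ → Axiom ((t ∶ φ) ▷ ((! t) ∶ (t ∶ φ)))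

IsCS : (Fm → Set) → Set
IsCS CS = ∀ χ → CS χ → Σ Const λ c → Σ Fm λ φ → (χ ≡ (con c ∶ φ)) × Axiom φ

data ⊢[_]_ (CS : Fm → Set) : Fm → Set where
  ax  : ∀ {φ} → Axiom φ → ⊢[ CS ] φ
  cs  : ∀ {φ} → CS φ → ⊢[ CS ] φ
  mp  : ∀ {φ ψ} → ⊢[ CS ] (φ ⊃ ψ) → ⊢[ CS ] φ → ⊢[ CS ] ψ
  rcn : ∀ {ψ} φ → ⊢[ CS ] ψ → ⊢[ CS ] (φ ▷ ψ)

⊥' : Fm
⊥' = atom 0 ∧' (¬' atom 0)

conj : List Fm → Fm
conj []       = ¬' ⊥'
conj (ψ ∷ ψs) = ψ ∧' conj ψs

_⊆_ : (Fm → Set) → (Fm → Set) → Set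
Γ ⊆ Δ = ∀ φ → Γ φ → Δ φ

_⊢[_]_ : (Fm → Set) → (Fm → Set) → Fm → Set
T ⊢[ CS ] φ = Σ (List Fm) λ ψs → All T ψs × (⊢[ CS ] (conj ψs ⊃ φ))

Consistent : (Fm → Set) → (Fm → Set) → Set
Consistent CS T = ¬ (T ⊢[ CS ] ⊥')

MCS : (Fm → Set) → (Fm → Set) → Set₁
MCS CS Γ = Consistent CS Γ × ((Δ : Fm → Set) → Γ ⊆ Δ → Consistent CS Δ → Δ ⊆ Γ)

-- Relational models (W, W_N, R_Fm, R_Tm, V).
-- V is split into its two uses: VN on normal states (sets of
-- propositional letters) and VF on non-normal states (sets of formulas).

record RelModel : Set₂ where
  field
    W  : Set₁
    WN : W → Set₁
    RF : Fm → W → W → Set₁           -- R_φ  (⊆ W_N × W_N)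
    RT : Tm → W → W → Set₁
    VN : W → Prop → Set
    VF : W → Fm → Set

module _ (M : RelModel) where
  open RelModel M

  Guard : W → Fm → Set₁ → Set₁
  Guard w φ clause = (¬ WN w → VF w φ) × (WN w → clause)

  _,_⊨_ : W → Fm → Set₁
  _,_⊨_ w (atom p) = Guard w (atom p) (Level.Lift (lsuc 0ℓ) (VN w p))
  _,_⊨_ w (¬' φ)   = Guard w (¬' φ) (¬ (_,_⊨_ w φ))
  _,_⊨_ w (φ ∧' ψ) = Guard w (φ ∧' ψ) ((_,_⊨_ w φ) × (_,_⊨_ w ψ))
  _,_⊨_ w (φ ⊃ ψ)  = Guard w (φ ⊃ ψ) (_,_⊨_ w φ → _,_⊨_ w ψ)
  _,_⊨_ w (φ ▷ ψ)  = Guard w (φ ▷ ψ) ((v : W) → RF φ w v → _,_⊨_ v ψ)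
  _,_⊨_ w (t ∶ φ)  = Guard w (t ∶ φ) ((v : W) → RT t w v → _,_⊨_ v φ)

_/F_ : (Fm → Set) → Fm → (Fm → Set)
(Γ /F φ) ψ = Γ (φ ▷ ψ)

_/T_ : (Fm → Set) → Tm → (Fm → Set)
(Γ /T t) ψ = Γ (t ∶ ψ)

Canonical : (Fm → Set) → RelModel
Canonical CS = record
  { W  = Fm → Set
  ; WN = MCS CS
  ; RF = λ φ Γ Δ → MCS CS Γ × MCS CS Δ × Level.Lift (lsuc 0ℓ) ((Γ /F φ) ⊆ Δ)
  ; RT = λ t Γ Δ → Level.Lift (lsuc 0ℓ) ((Γ /T t) ⊆ Δ)
  ; VN = λ Γ p → Γ (atom p)
  ; VF = λ Γ → Γ
  }

-- Maximal consistent sets are closed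
-- under derivability, and their membership is ¬¬-stable, which makes the
-- Boolean cases go through constructively. For φ > ψ ∉ Γ the set
-- Γ/φ ∪ {¬ψ} is consistent (by (RCN) and (A2), Γ/φ is deductively closed),
-- and a Lindenbaum extension along an injective coding of formulas gives
-- a normal R_φ-successor refuting ψ. For t : φ the successor Γ/t, though
-- in general not maximal consistent, is itself a state of the model, and
-- truth there is membership. Excluded middle is used only to decide
-- whether a state is normal.
module Submission where

open import Defs
open import Level using (0ℓ; lift; lower) renaming (suc to lsuc)
open import Axiom.ExcludedMiddle using (ExcludedMiddle)
open import Function using (_∘_)
open import Function.Bundles using (_⇔_; mk⇔; Equivalence)
open import Function.Construct.Composition using (_⇔-∘_)
open import Function.Related.TypeIsomorphisms using (→-cong-⇔; ¬-cong-⇔)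
open import Data.Nat using (ℕ; zero; suc; _+_; _⊔_; _≤′_; ≤′-refl; ≤′-step)
open import Data.Nat.Properties using (+-suc; +-identityʳ; suc-injective; ≤⇒≤′; m≤m⊔n; m≤n⊔m)
open import Data.Fin using (Fin; zero; suc)
open import Data.Vec using (Vec; []; _∷_; lookup; map)
open import Data.Vec.Properties using (lookup-map)
open import Data.Bool using (Bool; true; false; not; _∧_; _∨_; T)
open import Data.Bool.Properties using (∧-inverseʳ; T-≡; T-∧)
open import Data.Product using (Σ; ∃; _×_; _,_; proj₁; proj₂)
open import Data.Product.Properties using (,-injective)
open import Data.Product.Function.NonDependent.Propositional using (_×-⇔_)
open import Data.Sum using (_⊎_; inj₁; inj₂; [_,_])
import Data.Sum as Sum
open import Data.List using (List; []; _∷_; _++_)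
open import Data.List.Relation.Unary.All as All using (All; []; _∷_)
open import Data.List.Relation.Unary.All.Properties using (++⁺)
open import Data.List.Relation.Unary.Any using (here; there)
open import Data.List.Membership.Propositional using (_∈_)
open import Data.List.Membership.Propositional.Properties using (∈-++⁺ˡ; ∈-++⁺ʳ)
open import Data.Empty using (⊥)
open import Relation.Nullary using (¬_; yes; no)
open import Relation.Binary.PropositionalEquality using (_≡_; refl; sym; trans; cong; cong₂; module ≡-Reasoning)

private variable
  n : ℕ
  CS Θ Θ′ Γ : Fm → Set
  A B C P φ ψ χ : Fm
  xs ys : List Fm

-- Formulas are countable

next : ℕ × ℕ → ℕ × ℕ
next (zero  , b) = suc b , 0
next (suc a , b) = a , suc b

unpair : ℕ → ℕ × ℕ
unpair zero    = 0 , 0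
unpair (suc n) = next (unpair n)

unpair-onto : ∀ s a b → a + b ≡ s → ∃ λ n → unpair n ≡ (a , b)
unpair-onto _       zero    zero    _  = 0 , refl
unpair-onto (suc s) (suc a) zero    eq
  with n , p ← unpair-onto s zero a (trans (sym (+-identityʳ a)) (suc-injective eq))
  = suc n , cong next p
unpair-onto s       a       (suc b) eq
  with n , p ← unpair-onto s (suc a) b (trans (sym (+-suc a b)) eq)
  = suc n , cong next p

-- Opaque, so that pair is a rigid head when the implicit arguments of
-- pair-injective are inferred.
opaque
  pair : ℕ → ℕ → ℕ
  pair a b = proj₁ (unpair-onto (a + b) a b refl)

  pair-injective : ∀ {a b c d} → pair a b ≡ pair c d → a ≡ c × b ≡ d
  pair-injective {a} {b} {c} {d} eq = ,-injective (begin
    (a , b)           ≡⟨ sym (proj₂ (unpair-onto (a + b) a b refl)) ⟩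
    unpair (pair a b) ≡⟨ cong unpair eq ⟩
    unpair (pair c d) ≡⟨ proj₂ (unpair-onto (c + d) c d refl) ⟩
    (c , d)           ∎)
    where open ≡-Reasoning

data Tree : Set where
  leaf : ℕ → Tree
  node : ℕ → Tree → Tree → Tree

tree-code : Tree → ℕ
tree-code (leaf n)     = pair 0 n
tree-code (node k l r) = pair (suc k) (pair (tree-code l) (tree-code r))

tree-code-injective : ∀ s t → tree-code s ≡ tree-code t → s ≡ t
tree-code-injective (leaf m) (leaf n) eq = cong leaf (proj₂ (pair-injective eq))
tree-code-injective (leaf _) (node _ _ _) eq with () ← proj₁ (pair-injective eq)
tree-code-injective (node _ _ _) (leaf _) eq with () ← proj₁ (pair-injective eq)
tree-code-injective (node k l r) (node _ l′ r′) eq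
  with refl , eq′ ← pair-injective eq
  with l≡ , r≡ ← pair-injective eq′
  = cong₂ (node k) (tree-code-injective l l′ l≡) (tree-code-injective r r′ r≡)

tm-tree : Tm → Tree
tm-tree (con c) = node 0 (leaf c) (leaf 0)
tm-tree (var x) = node 1 (leaf x) (leaf 0)
tm-tree (s · t) = node 2 (tm-tree s) (tm-tree t)
tm-tree (s ⊕ t) = node 3 (tm-tree s) (tm-tree t)
tm-tree (! t)   = node 4 (tm-tree t) (leaf 0)

tree-tm : Tree → Tm
tree-tm (node 0 (leaf c) _) = con c
tree-tm (node 1 (leaf x) _) = var x
tree-tm (node 2 s t)        = tree-tm s · tree-tm t
tree-tm (node 3 s t)        = tree-tm s ⊕ tree-tm t
tree-tm (node 4 t _)        = ! tree-tm t
tree-tm _                   = con 0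

tree-tm-inverse : ∀ t → tree-tm (tm-tree t) ≡ t
tree-tm-inverse (con c) = refl
tree-tm-inverse (var x) = refl
tree-tm-inverse (s · t) = cong₂ _·_ (tree-tm-inverse s) (tree-tm-inverse t)
tree-tm-inverse (s ⊕ t) = cong₂ _⊕_ (tree-tm-inverse s) (tree-tm-inverse t)
tree-tm-inverse (! t)   = cong !_ (tree-tm-inverse t)

fm-tree : Fm → Tree
fm-tree (atom p) = node 0 (leaf p) (leaf 0)
fm-tree (¬' φ)   = node 1 (fm-tree φ) (leaf 0)
fm-tree (φ ∧' ψ) = node 2 (fm-tree φ) (fm-tree ψ)
fm-tree (φ ⊃ ψ)  = node 3 (fm-tree φ) (fm-tree ψ)
fm-tree (φ ▷ ψ)  = node 4 (fm-tree φ) (fm-tree ψ)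
fm-tree (t ∶ φ)  = node 5 (tm-tree t) (fm-tree φ)

tree-fm : Tree → Fm
tree-fm (node 0 (leaf p) _) = atom p
tree-fm (node 1 φ _)        = ¬' tree-fm φ
tree-fm (node 2 φ ψ)        = tree-fm φ ∧' tree-fm ψ
tree-fm (node 3 φ ψ)        = tree-fm φ ⊃ tree-fm ψ
tree-fm (node 4 φ ψ)        = tree-fm φ ▷ tree-fm ψ
tree-fm (node 5 t φ)        = tree-tm t ∶ tree-fm φ
tree-fm _                   = atom 0

tree-fm-inverse : ∀ φ → tree-fm (fm-tree φ) ≡ φ
tree-fm-inverse (atom p) = refl
tree-fm-inverse (¬' φ)   = cong ¬'_ (tree-fm-inverse φ)
tree-fm-inverse (φ ∧' ψ) = cong₂ _∧'_ (tree-fm-inverse φ) (tree-fm-inverse ψ)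
tree-fm-inverse (φ ⊃ ψ)  = cong₂ _⊃_ (tree-fm-inverse φ) (tree-fm-inverse ψ)
tree-fm-inverse (φ ▷ ψ)  = cong₂ _▷_ (tree-fm-inverse φ) (tree-fm-inverse ψ)
tree-fm-inverse (t ∶ φ)  = cong₂ _∶_ (tree-tm-inverse t) (tree-fm-inverse φ)

code : Fm → ℕ
code = tree-code ∘ fm-tree

code-injective : code φ ≡ code ψ → φ ≡ ψ
code-injective {φ} {ψ} eq = begin
  φ                   ≡⟨ sym (tree-fm-inverse φ) ⟩
  tree-fm (fm-tree φ) ≡⟨ cong tree-fm (tree-code-injective _ _ eq) ⟩
  tree-fm (fm-tree ψ) ≡⟨ tree-fm-inverse ψ ⟩
  ψ                   ∎
  where open ≡-Reasoning

-- Tautologies, checked by truth tables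

infixr 4 _⊃ˢ_
infixr 5 _∧ˢ_
data Schema (n : ℕ) : Set where
  ‵_        : Fin n → Schema n
  ⊥ˢ        : Schema n
  ¬ˢ_       : Schema n → Schema n
  _∧ˢ_ _⊃ˢ_ : Schema n → Schema n → Schema n

𝑝 : Schema (suc n)
𝑝 = ‵ zero

𝑞 : Schema (2 + n)
𝑞 = ‵ suc zero

𝑟 : Schema (3 + n)
𝑟 = ‵ suc (suc zero)

𝑠 : Schema (4 + n)
𝑠 = ‵ suc (suc (suc zero))

⟦_⟧ : Schema n → Vec Fm n → Fm
⟦ ‵ i    ⟧ σ = lookup σ i
⟦ ⊥ˢ     ⟧ σ = ⊥'
⟦ ¬ˢ S   ⟧ σ = ¬' ⟦ S ⟧ σ
⟦ S ∧ˢ R ⟧ σ = ⟦ S ⟧ σ ∧' ⟦ R ⟧ σ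
⟦ S ⊃ˢ R ⟧ σ = ⟦ S ⟧ σ ⊃ ⟦ R ⟧ σ

⟦_⟧ᵇ : Schema n → Vec Bool n → Bool
⟦ ‵ i    ⟧ᵇ ρ = lookup ρ i
⟦ ⊥ˢ     ⟧ᵇ ρ = false
⟦ ¬ˢ S   ⟧ᵇ ρ = not (⟦ S ⟧ᵇ ρ)
⟦ S ∧ˢ R ⟧ᵇ ρ = ⟦ S ⟧ᵇ ρ ∧ ⟦ R ⟧ᵇ ρ
⟦ S ⊃ˢ R ⟧ᵇ ρ = not (⟦ S ⟧ᵇ ρ) ∨ ⟦ R ⟧ᵇ ρ

evalB-⟦⟧ : ∀ v (S : Schema n) σ → evalB v (⟦ S ⟧ σ) ≡ ⟦ S ⟧ᵇ (map (evalB v) σ)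
evalB-⟦⟧ v (‵ i)    σ = sym (lookup-map i (evalB v) σ)
evalB-⟦⟧ v ⊥ˢ       σ = ∧-inverseʳ (v (atom 0))
evalB-⟦⟧ v (¬ˢ S)   σ = cong not (evalB-⟦⟧ v S σ)
evalB-⟦⟧ v (S ∧ˢ R) σ = cong₂ _∧_ (evalB-⟦⟧ v S σ) (evalB-⟦⟧ v R σ)
evalB-⟦⟧ v (S ⊃ˢ R) σ = cong₂ (λ a b → not a ∨ b) (evalB-⟦⟧ v S σ) (evalB-⟦⟧ v R σ)

all-true : ∀ n → (Vec Bool n → Bool) → Bool
all-true zero    f = f []
all-true (suc n) f = all-true n (f ∘ (true ∷_)) ∧ all-true n (f ∘ (false ∷_))

all-true-sound : ∀ n f → T (all-true n f) → ∀ ρ → f ρ ≡ true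
all-true-sound zero    f ok []          = Equivalence.to T-≡ ok
all-true-sound (suc n) f ok (true ∷ ρ)  = all-true-sound n _ (proj₁ (Equivalence.to T-∧ ok)) ρ
all-true-sound (suc n) f ok (false ∷ ρ) = all-true-sound n _ (proj₂ (Equivalence.to T-∧ ok)) ρ

tautology : (S : Schema n) → T (all-true n ⟦ S ⟧ᵇ) → (σ : Vec Fm n) → Tautology (⟦ S ⟧ σ)
tautology {n} S valid σ v = trans (evalB-⟦⟧ v S σ) (all-true-sound n ⟦ S ⟧ᵇ valid (map (evalB v) σ))

weakening : Axiom (A ⊃ B ⊃ A)
weakening {A} {B} = A1 (tautology (𝑝 ⊃ˢ 𝑞 ⊃ˢ 𝑝) _ (A ∷ B ∷ []))

∧-elimˡ : Axiom (A ∧' B ⊃ A)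
∧-elimˡ {A} {B} = A1 (tautology (𝑝 ∧ˢ 𝑞 ⊃ˢ 𝑝) _ (A ∷ B ∷ []))

∧-elimʳ : Axiom (A ∧' B ⊃ B)
∧-elimʳ {A} {B} = A1 (tautology (𝑝 ∧ˢ 𝑞 ⊃ˢ 𝑞) _ (A ∷ B ∷ []))

∧-intro : Axiom (A ⊃ B ⊃ A ∧' B)
∧-intro {A} {B} = A1 (tautology (𝑝 ⊃ˢ 𝑞 ⊃ˢ 𝑝 ∧ˢ 𝑞) _ (A ∷ B ∷ []))

⊤-intro : Axiom (¬' ⊥')
⊤-intro = A1 (tautology {0} (¬ˢ ⊥ˢ) _ [])

modus-ponens : Axiom (A ⊃ (A ⊃ B) ⊃ B)
modus-ponens {A} {B} = A1 (tautology (𝑝 ⊃ˢ (𝑝 ⊃ˢ 𝑞) ⊃ˢ 𝑞) _ (A ∷ B ∷ []))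

syllogism : Axiom ((A ⊃ B) ⊃ (B ⊃ C) ⊃ A ⊃ C)
syllogism {A} {B} {C} = A1 (tautology ((𝑝 ⊃ˢ 𝑞) ⊃ˢ (𝑞 ⊃ˢ 𝑟) ⊃ˢ 𝑝 ⊃ˢ 𝑟) _ (A ∷ B ∷ C ∷ []))

curry : Axiom ((A ∧' B ⊃ C) ⊃ B ⊃ A ⊃ C)
curry {A} {B} {C} = A1 (tautology ((𝑝 ∧ˢ 𝑞 ⊃ˢ 𝑟) ⊃ˢ 𝑞 ⊃ˢ 𝑝 ⊃ˢ 𝑟) _ (A ∷ B ∷ C ∷ []))

distribute : Axiom ((A ⊃ B ⊃ C) ⊃ (P ⊃ A) ⊃ (P ⊃ B) ⊃ P ⊃ C)
distribute {A} {B} {C} {P} =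
  A1 (tautology ((𝑝 ⊃ˢ 𝑞 ⊃ˢ 𝑟) ⊃ˢ (𝑠 ⊃ˢ 𝑝) ⊃ˢ (𝑠 ⊃ˢ 𝑞) ⊃ˢ 𝑠 ⊃ˢ 𝑟) _ (A ∷ B ∷ C ∷ P ∷ []))

contradiction : Axiom (A ⊃ ¬' A ⊃ ⊥')
contradiction {A} = A1 (tautology (𝑝 ⊃ˢ ¬ˢ 𝑝 ⊃ˢ ⊥ˢ) _ (A ∷ []))

reductio : Axiom ((¬' A ⊃ ⊥') ⊃ A)
reductio {A} = A1 (tautology ((¬ˢ 𝑝 ⊃ˢ ⊥ˢ) ⊃ˢ 𝑝) _ (A ∷ []))

¬⊃-antecedent : Axiom (¬' (A ⊃ B) ⊃ A)
¬⊃-antecedent {A} {B} = A1 (tautology (¬ˢ (𝑝 ⊃ˢ 𝑞) ⊃ˢ 𝑝) _ (A ∷ B ∷ []))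

¬⊃-consequent : Axiom (¬' (A ⊃ B) ⊃ ¬' B)
¬⊃-consequent {A} {B} = A1 (tautology (¬ˢ (𝑝 ⊃ˢ 𝑞) ⊃ˢ ¬ˢ 𝑞) _ (A ∷ B ∷ []))

-- Derivations

ax-mp : Axiom (A ⊃ B) → ⊢[ CS ] A → ⊢[ CS ] B
ax-mp t = mp (ax t)

⊢-trans : ⊢[ CS ] (A ⊃ B) → ⊢[ CS ] (B ⊃ C) → ⊢[ CS ] (A ⊃ C)
⊢-trans d e = mp (mp (ax syllogism) d) e

⊢-under₁ : Axiom (A ⊃ B) → ⊢[ CS ] (P ⊃ A) → ⊢[ CS ] (P ⊃ B)
⊢-under₁ t d = ⊢-trans d (ax t)

⊢-under₂ : Axiom (A ⊃ B ⊃ C) → ⊢[ CS ] (P ⊃ A) → ⊢[ CS ] (P ⊃ B) → ⊢[ CS ] (P ⊃ C)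
⊢-under₂ t d e = mp (mp (mp (ax distribute) (ax t)) d) e

conj-∈ : ψ ∈ xs → ⊢[ CS ] (conj xs ⊃ ψ)
conj-∈ (here refl) = ax ∧-elimˡ
conj-∈ (there i)   = ⊢-trans (ax ∧-elimʳ) (conj-∈ i)

conj-⊆ : All (_∈ ys) xs → ⊢[ CS ] (conj ys ⊃ conj xs)
conj-⊆ []       = ax-mp weakening (ax ⊤-intro)
conj-⊆ (i ∷ is) = ⊢-under₂ ∧-intro (conj-∈ i) (conj-⊆ is)

infixl 25 _∪｛_｝
_∪｛_｝ : (Fm → Set) → Fm → Fm → Set
(Θ ∪｛ χ ｝) φ = Θ φ ⊎ φ ≡ χ

∈⇒⊢ : Θ φ → Θ ⊢[ CS ] φ
∈⇒⊢ x = _ , x ∷ [] , ax ∧-elimˡ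

theorem⇒⊢ : ⊢[ CS ] φ → Θ ⊢[ CS ] φ
theorem⇒⊢ d = [] , [] , ax-mp weakening d

consequence₁ : Axiom (A ⊃ B) → Θ ⊢[ CS ] A → Θ ⊢[ CS ] B
consequence₁ t (xs , xs∈Θ , d) = xs , xs∈Θ , ⊢-under₁ t d

consequence₂ : Axiom (A ⊃ B ⊃ C) → Θ ⊢[ CS ] A → Θ ⊢[ CS ] B → Θ ⊢[ CS ] C
consequence₂ t (xs , xs∈Θ , d) (ys , ys∈Θ , e) =
  xs ++ ys , ++⁺ xs∈Θ ys∈Θ ,
  ⊢-under₂ t (⊢-trans (conj-⊆ (All.tabulate ∈-++⁺ˡ)) d)
             (⊢-trans (conj-⊆ (All.tabulate (∈-++⁺ʳ xs))) e)

All-∪｛｝ : All (Θ ∪｛ χ ｝) xs →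
          Σ (List Fm) λ ys → All Θ ys × All (λ x → x ≡ χ ⊎ x ∈ ys) xs
All-∪｛｝ [] = [] , [] , []
All-∪｛｝ (inj₁ x∈Θ ∷ xs∈) with ys , ys∈Θ , xs⊆ ← All-∪｛｝ xs∈ =
  _ ∷ ys , x∈Θ ∷ ys∈Θ , inj₂ (here refl) ∷ All.map (Sum.map₂ there) xs⊆
All-∪｛｝ (inj₂ x≡χ ∷ xs∈) with ys , ys∈Θ , xs⊆ ← All-∪｛｝ xs∈ =
  ys , ys∈Θ , inj₁ x≡χ ∷ xs⊆

deduction : Θ ∪｛ χ ｝ ⊢[ CS ] φ → Θ ⊢[ CS ] (χ ⊃ φ)
deduction (xs , xs∈ , d) with ys , ys∈Θ , xs⊆ ← All-∪｛｝ xs∈ =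
  ys , ys∈Θ , ax-mp curry (⊢-trans (conj-⊆ (All.map [ here , there ] xs⊆)) d)

⊢-mono : Θ ⊆ Θ′ → Θ ⊢[ CS ] φ → Θ′ ⊢[ CS ] φ
⊢-mono Θ⊆Θ′ (xs , xs∈Θ , d) = xs , All.map (Θ⊆Θ′ _) xs∈Θ , d

-- Maximal consistent sets

module MCS-Properties {CS Γ : Fm → Set} (Γ-mcs : MCS CS Γ) where

  private
    consistent : Consistent CS Γ
    consistent = proj₁ Γ-mcs

    maximal : (Δ : Fm → Set) → Γ ⊆ Δ → Consistent CS Δ → Δ ⊆ Γ
    maximal = proj₂ Γ-mcs

  ∈-if-irrefutable : ¬ (Γ ⊢[ CS ] (φ ⊃ ⊥')) → Γ φ
  ∈-if-irrefutable {φ} ¬refutable =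
    maximal (Γ ∪｛ φ ｝) (λ _ → inj₁) (¬refutable ∘ deduction) φ (inj₂ refl)

  closed : Γ ⊢[ CS ] φ → Γ φ
  closed d = ∈-if-irrefutable (consistent ∘ consequence₂ modus-ponens d)

  stable : ¬ ¬ Γ φ → Γ φ
  stable ¬¬φ = ∈-if-irrefutable λ r →
    ¬¬φ λ φ∈ → consistent (consequence₂ modus-ponens (∈⇒⊢ φ∈) r)

  theorem-∈ : ⊢[ CS ] φ → Γ φ
  theorem-∈ = closed ∘ theorem⇒⊢

  ax-∈₁ : Axiom (A ⊃ B) → Γ A → Γ B
  ax-∈₁ t a = closed (consequence₁ t (∈⇒⊢ a))

  ax-∈₂ : Axiom (A ⊃ B ⊃ C) → Γ A → Γ B → Γ C
  ax-∈₂ t a b = closed (consequence₂ t (∈⇒⊢ a) (∈⇒⊢ b))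

  mp-∈ : Γ (A ⊃ B) → Γ A → Γ B
  mp-∈ ab a = ax-∈₂ modus-ponens a ab

  not-both : Γ φ → Γ (¬' φ) → ⊥
  not-both φ∈ ¬φ∈ = consistent (consequence₂ contradiction (∈⇒⊢ φ∈) (∈⇒⊢ ¬φ∈))

  ¬-∈⇔ : (¬ Γ φ) ⇔ Γ (¬' φ)
  ¬-∈⇔ = mk⇔ (λ φ∉ → ∈-if-irrefutable (φ∉ ∘ closed ∘ consequence₁ reductio))
             (λ ¬φ∈ φ∈ → not-both φ∈ ¬φ∈)

  ∧-∈⇔ : (Γ A × Γ B) ⇔ Γ (A ∧' B)
  ∧-∈⇔ = mk⇔ (λ (a , b) → ax-∈₂ ∧-intro a b)
             (λ ab → ax-∈₁ ∧-elimˡ ab , ax-∈₁ ∧-elimʳ ab)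

  ⊃-∈⇔ : (Γ A → Γ B) ⇔ Γ (A ⊃ B)
  ⊃-∈⇔ = mk⇔ implication mp-∈
    where
      implication : (Γ A → Γ B) → Γ (A ⊃ B)
      implication f = stable λ A⊃B∉ →
        let ¬A⊃B∈ = Equivalence.to ¬-∈⇔ A⊃B∉
        in not-both (f (ax-∈₁ ¬⊃-antecedent ¬A⊃B∈)) (ax-∈₁ ¬⊃-consequent ¬A⊃B∈)

  ▷-mp : Γ (φ ▷ (A ⊃ B)) → Γ (φ ▷ A) → Γ (φ ▷ B)
  ▷-mp = mp-∈ ∘ mp-∈ (theorem-∈ (ax (A2 _ _ _)))

  ▷-conj : All (Γ /F φ) xs → Γ (φ ▷ conj xs)
  ▷-conj []         = theorem-∈ (rcn _ (ax ⊤-intro))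
  ▷-conj (x∈ ∷ xs∈) = ▷-mp (▷-mp (theorem-∈ (rcn _ (ax ∧-intro))) x∈) (▷-conj xs∈)

  /F-closed : (Γ /F φ) ⊢[ CS ] ψ → Γ (φ ▷ ψ)
  /F-closed (xs , xs∈ , d) = ▷-mp (theorem-∈ (rcn _ d)) (▷-conj xs∈)

-- Lindenbaum's lemma

⋃ : (ℕ → Fm → Set) → Fm → Set
⋃ S φ = ∃ λ n → S n φ

module Chain (S : ℕ → Fm → Set) (S-step : ∀ n → S n ⊆ S (suc n)) where

  chain-mono : ∀ {m n} → m ≤′ n → S m ⊆ S n
  chain-mono ≤′-refl        _ x = x
  chain-mono (≤′-step m≤′n) φ x = S-step _ φ (chain-mono m≤′n φ x)

  ⋃-finite : All (⋃ S) xs → ∃ λ n → All (S n) xs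
  ⋃-finite [] = 0 , []
  ⋃-finite ((m , x) ∷ xs∈) with n , xs∈′ ← ⋃-finite xs∈ =
    m ⊔ n , chain-mono (≤⇒≤′ (m≤m⊔n m n)) _ x ∷ All.map (chain-mono (≤⇒≤′ (m≤n⊔m m n)) _) xs∈′

  ⋃-consistent : (∀ n → Consistent CS (S n)) → Consistent CS (⋃ S)
  ⋃-consistent S-consistent (xs , xs∈ , d) with n , xs∈′ ← ⋃-finite xs∈ =
    S-consistent n (xs , xs∈′ , d)

All-⊎-unique : {P Q : Fm → Set} → (∀ {x y} → Q x → Q y → x ≡ y) →
               All (λ x → P x ⊎ Q x) xs →
               All P xs ⊎ ∃ λ y → Q y × All (λ x → P x ⊎ x ≡ y) xs
All-⊎-unique Q-unique [] = inj₁ []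
All-⊎-unique Q-unique (p ∷ ps) with All-⊎-unique Q-unique ps | p
... | inj₁ ps′            | inj₁ x = inj₁ (x ∷ ps′)
... | inj₁ ps′            | inj₂ q = inj₂ (_ , q , inj₂ refl ∷ All.map inj₁ ps′)
... | inj₂ (y , qy , ps′) | _      = inj₂ (y , qy , Sum.map₂ (λ q → Q-unique q qy) p ∷ ps′)

module Lindenbaum {CS : Fm → Set} (S : Fm → Set) (S-consistent : Consistent CS S) where

  Admissible : (Fm → Set) → ℕ → Fm → Set
  Admissible Θ n χ = code χ ≡ n × Consistent CS (Θ ∪｛ χ ｝)

  admissible-unique : Admissible Θ n χ → Admissible Θ n ψ → χ ≡ ψ
  admissible-unique (χ≡n , _) (ψ≡n , _) = code-injective (trans χ≡n (sym ψ≡n))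

  stage : ℕ → Fm → Set
  stage zero      = S
  stage (suc n) χ = stage n χ ⊎ Admissible (stage n) n χ

  stage-consistent : ∀ n → Consistent CS (stage n)
  stage-consistent zero = S-consistent
  stage-consistent (suc n) (xs , xs∈ , d) with All-⊎-unique admissible-unique xs∈
  ... | inj₁ xs∈′                            = stage-consistent n (xs , xs∈′ , d)
  ... | inj₂ (_ , (_ , χ-consistent) , xs∈′) = χ-consistent (xs , xs∈′ , d)

  Δ : Fm → Set
  Δ = ⋃ stage

  Δ-consistent : Consistent CS Δ
  Δ-consistent = Chain.⋃-consistent stage (λ _ _ → inj₁) stage-consistent

  Δ-maximal : (Θ : Fm → Set) → Δ ⊆ Θ → Consistent CS Θ → Θ ⊆ Δ
  Δ-maximal Θ Δ⊆Θ Θ-consistent χ χ∈Θ =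
    suc (code χ) , inj₂ (refl , Θ-consistent ∘ ⊢-mono stage∪χ⊆Θ)
    where
      stage∪χ⊆Θ : stage (code χ) ∪｛ χ ｝ ⊆ Θ
      stage∪χ⊆Θ _ (inj₁ x)    = Δ⊆Θ _ (code χ , x)
      stage∪χ⊆Θ _ (inj₂ refl) = χ∈Θ

lindenbaum : (S : Fm → Set) → Consistent CS S → Σ (Fm → Set) λ Δ → MCS CS Δ × S ⊆ Δ
lindenbaum S S-consistent = Δ , (Δ-consistent , Δ-maximal) , λ _ x → 0 , x
  where open Lindenbaum S S-consistent

-- The truth lemma

module Truth (em : ExcludedMiddle (lsuc 0ℓ)) (CS : Fm → Set) where

  open RelModel (Canonical CS) using (RF; RT)
  open MCS-Properties

  𝓜 : RelModel
  𝓜 = Canonical CS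

  guard : {C : Set₁} → (MCS CS Γ → C ⇔ Γ φ) → Guard 𝓜 Γ φ C ⇔ Γ φ
  guard {Γ} {C = C} normal⇔ =
    mk⇔ to (λ φ∈ → (λ _ → φ∈) , (λ Γ-mcs → Equivalence.from (normal⇔ Γ-mcs) φ∈))
    where
      to : Guard 𝓜 Γ _ C → Γ _
      to (non-normal , normal) with em {MCS CS Γ}
      ... | yes Γ-mcs = Equivalence.to (normal⇔ Γ-mcs) (normal Γ-mcs)
      ... | no ¬Γ-mcs = non-normal ¬Γ-mcs

  ▷-truth : MCS CS Γ → (∀ Δ → (𝓜 , Δ ⊨ ψ) ⇔ Δ ψ) →
            (∀ Δ → RF φ Γ Δ → 𝓜 , Δ ⊨ ψ) ⇔ Γ (φ ▷ ψ)
  ▷-truth {Γ} {ψ} {φ} Γ-mcs truth-ψ = mk⇔ to from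
    where
      refutation-consistent : ¬ Γ (φ ▷ ψ) → Consistent CS ((Γ /F φ) ∪｛ ¬' ψ ｝)
      refutation-consistent φ▷ψ∉ = φ▷ψ∉ ∘ /F-closed Γ-mcs ∘ consequence₁ reductio ∘ deduction

      to : (∀ Δ → RF φ Γ Δ → 𝓜 , Δ ⊨ ψ) → Γ (φ ▷ ψ)
      to succ⊨ψ = stable Γ-mcs λ φ▷ψ∉ →
        let Δ , Δ-mcs , S⊆Δ = lindenbaum _ (refutation-consistent φ▷ψ∉)
            Γ/φ⊆Δ = λ χ → S⊆Δ χ ∘ inj₁
        in not-both Δ-mcs (Equivalence.to (truth-ψ Δ) (succ⊨ψ Δ (Γ-mcs , Δ-mcs , lift Γ/φ⊆Δ)))
                          (S⊆Δ _ (inj₂ refl))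

      from : Γ (φ ▷ ψ) → ∀ Δ → RF φ Γ Δ → 𝓜 , Δ ⊨ ψ
      from φ▷ψ∈ Δ (_ , _ , lift Γ/φ⊆Δ) = Equivalence.from (truth-ψ Δ) (Γ/φ⊆Δ ψ φ▷ψ∈)

  -- Γ/t is an R_t-successor of Γ whether or not it is maximal consistent,
  -- which is why the canonical model has a state for every set of formulas.
  ∶-truth : ∀ Γ t → (∀ Δ → (𝓜 , Δ ⊨ φ) ⇔ Δ φ) → (∀ Δ → RT t Γ Δ → 𝓜 , Δ ⊨ φ) ⇔ Γ (t ∶ φ)
  ∶-truth {φ} Γ t truth-φ = mk⇔
    (λ succ⊨φ → Equivalence.to (truth-φ (Γ /T t)) (succ⊨φ (Γ /T t) (lift λ _ x → x)))
    (λ t∶φ∈ Δ (lift Γ/t⊆Δ) → Equivalence.from (truth-φ Δ) (Γ/t⊆Δ φ t∶φ∈))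

  truth : ∀ φ Γ → (𝓜 , Γ ⊨ φ) ⇔ Γ φ
  truth (atom p) Γ = guard λ _ → mk⇔ lower lift
  truth (¬' φ)   Γ = guard λ Γ-mcs → ¬-∈⇔ Γ-mcs ⇔-∘ ¬-cong-⇔ (truth φ Γ)
  truth (φ ∧' ψ) Γ = guard λ Γ-mcs → ∧-∈⇔ Γ-mcs ⇔-∘ (truth φ Γ ×-⇔ truth ψ Γ)
  truth (φ ⊃ ψ)  Γ = guard λ Γ-mcs → ⊃-∈⇔ Γ-mcs ⇔-∘ →-cong-⇔ (truth φ Γ) (truth ψ Γ)
  truth (φ ▷ ψ)  Γ = guard λ Γ-mcs → ▷-truth Γ-mcs (truth ψ)
  truth (t ∶ φ)  Γ = guard λ _ → ∶-truth Γ t (truth φ)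

lemma6 : ExcludedMiddle (lsuc 0ℓ) → (CS : Fm → Set) → IsCS CS →
         (φ : Fm) (Γ : Fm → Set) → (Canonical CS , Γ ⊨ φ) ⇔ Γ φ
lemma6 em CS _ = Truth.truth em CS
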